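{- Let $H\le G_{d,k}$. For a vertex $v=[K_{\widehat i}g]_H$ of $\mathfrak X_{d,k}(H)$ define $\mathcal A_v=\{g'\in G_{d,k}:[K_{\widehat i}g]_H=[K_{\widehat i}g']_H\}$, and let $\mathcal A=(\mathcal A_v)_{v\in\mathfrak X^0_{d,k}(H)}$. Then $\mathfrak X_{d,k}(H)=\mathcal N(\mathcal A)$.
   Context: $G_{d,k}=\langle\alpha_0,\dots,\alpha_d\mid\alpha_i^k=e\rangle$ ($d,k\ge1$), $[\![d]\!]=\{0,\dots,d\}$. For $J\subseteq[\![d]\!]$, $K_J=\langle\alpha_j:j\in J\rangle$, $\widehat J=[\![d]\!]\setminus J$, $\widehat i=\widehat{\{i\}}$. For $H\le G_{d,k}$, right cosets $K_{\widehat J}g$ and $K_{\widehat{J'}}g'$ are equivalent if $\{K_{\widehat J}gh:h\in H\}=\{K_{\widehat{J'}}g'h:h\in H\}$; $[K_{\widehat J}g]_H$ is the class and $\mathcal M(H)$ the set of all classes ($J$ ranging over all subsets, $g$ over $G_{d,k}$). The map $\Phi([K_{\widehat J}g]_H)=\{[K_{\widehat i}g]_H:i\in J\}$ is well defined and $\mathfrak X_{d,k}(H)=\{\Phi(c):c\in\mathcal M(H)\}$, a simplicial complex whose vertex set $\mathfrak X^0_{d,k}(H)$ is the set of classes $[K_{\widehat i}g]_H$. The nerve complex $\mathcal N(\mathcal A)$ of a family $(\mathcal A_v)_{v\in I}$ of nonempty sets is the simplicial complex on vertex set $I$ whose cells are the finite $\sigma\subseteq I$ with $\bigcap_{v\in\sigma}\mathcal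 A_v\ne\emptyset$. -}

module Defs where

open import Data.Nat using (ℕ; _∸_)
open import Data.Fin using (Fin)
open import Data.Fin.Subset using (Subset; _∈_; _∉_; ⁅_⁆)
open import Data.List using (List; []; _++_; replicate; reverse; concatMap)
open import Data.List.Relation.Unary.All using (All)
open import Data.List.Relation.Unary.Any using (Any)
open import Data.Product using (Σ; ∃; _×_; _,_)
open import Relation.Binary.PropositionalEquality using (_≡_)

-- Elements of G_{d,k} = ⟨α_0,…,α_d ∣ α_i^k = e⟩ are represented by words
-- in the generators: the letter i : Fin (suc d) stands for α_i.
-- (Since α_i⁻¹ = α_i^{k-1}, the monoid presentation below presents the group.)
Word : ℕ → Set
Word d = List (Fin (ℕ.suc d))

data _≈⟨_⟩_ {d : ℕ} : Word d → ℕ → Word d → Set where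
  ≈-refl  : ∀ {k x} → x ≈⟨ k ⟩ x
  ≈-sym   : ∀ {k x y} → x ≈⟨ k ⟩ y → y ≈⟨ k ⟩ x
  ≈-trans : ∀ {k x y z} → x ≈⟨ k ⟩ y → y ≈⟨ k ⟩ z → x ≈⟨ k ⟩ z
  ≈-rel   : ∀ {k} (u v : Word d) (i : Fin (ℕ.suc d)) →
            (u ++ replicate k i ++ v) ≈⟨ k ⟩ (u ++ v)

inv : ∀ {d} → ℕ → Word d → Word d
inv k x = concatMap (λ i → replicate (k ∸ 1) i) (reverse x)

record IsSubgroup (d k : ℕ) (H : Word d → Set) : Set where
  field
    resp   : ∀ {x y} → x ≈⟨ k ⟩ y → H x → H y
    has-e  : H []
    closed : ∀ {x y} → H x → H y → H (x ++ y)
    has-inv : ∀ {x} → H x → H (inv k x)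

-- Membership x ∈ K_{Ĵ} g : x = w g with w a word in the generators α_j, j ∉ J
-- (K_{Ĵ} is the subgroup generated by those α_j; inverses are powers).
InCoset : ∀ {d} (k : ℕ) (J : Subset (ℕ.suc d)) (g x : Word d) → Set
InCoset k J g x = Σ _ λ w → All (λ j → j ∉ J) w × (x ≈⟨ k ⟩ (w ++ g))

SameCoset : ∀ {d} (k : ℕ) (J : Subset (ℕ.suc d)) (a b : Word d) → Set
SameCoset k J a b =
  ∀ x → (InCoset k J a x → InCoset k J b x) × (InCoset k J b x → InCoset k J a x)

-- Equivalence of (typed) cosets K_{Ĵ} g and K_{Ĵ'} g' w.r.t. H:
-- {K_{Ĵ} g h : h ∈ H} = {K_{Ĵ'} g' h : h ∈ H}, cosets carrying their type J.
ClassEq : ∀ {d} (k : ℕ) (H : Word d → Set) →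
          Subset (ℕ.suc d) → Word d → Subset (ℕ.suc d) → Word d → Set
ClassEq k H J g J' g' =
  J ≡ J' ×
  ((∀ h → H h → Σ _ λ h' → H h' × SameCoset k J (g ++ h) (g' ++ h')) ×
   (∀ h' → H h' → Σ _ λ h → H h × SameCoset k J (g ++ h) (g' ++ h')))

-- A vertex [K_î g]_H is represented by the pair (i , g).
Vertex : ℕ → Set
Vertex d = Fin (ℕ.suc d) × Word d

VertexEq : ∀ {d} (k : ℕ) (H : Word d → Set) → Vertex d → Vertex d → Set
VertexEq k H (i , g) (i' , g') = ClassEq k H ⁅ i ⁆ g ⁅ i' ⁆ g'

𝒜 : ∀ {d} (k : ℕ) (H : Word d → Set) → Vertex d → Word d → Set
𝒜 k H (i , g) g' = ClassEq k H ⁅ i ⁆ g ⁅ i ⁆ g'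

-- A finite set σ of vertices (given by a list of representatives) is a cell of
-- 𝔛_{d,k}(H) iff σ = Φ([K_Ĵ g]_H) = {[K_î g]_H : i ∈ J} for some J, g
-- (equality of sets of classes).
IsCell𝔛 : ∀ {d} (k : ℕ) (H : Word d → Set) → List (Vertex d) → Set
IsCell𝔛 {d} k H σ =
  Σ (Subset (ℕ.suc d)) λ J → Σ (Word d) λ g →
    All (λ v → Σ (Fin (ℕ.suc d)) λ i → i ∈ J × VertexEq k H v (i , g)) σ ×
    (∀ i → i ∈ J → Any (λ v → VertexEq k H v (i , g)) σ)

IsCell𝒩 : ∀ {d} (k : ℕ) (H : Word d → Set) → List (Vertex d) → Set
IsCell𝒩 {d} k H σ = Σ (Word d) λ g' → All (λ v → 𝒜 k H v g') σ

-- A vertex [K_î g']_H equals [K_î g]_H exactly when g ∈ 𝒜_[K_î g']_H. So if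
-- σ = Φ([K_Ĵ g]_H), then g lies in every 𝒜_v with v ∈ σ; conversely, a common
-- point g of the 𝒜_v exhibits σ as Φ([K_Ĵ g]_H) for J the set of types of the
-- vertices of σ.
module Submission where

open import Defs
open import Data.Nat using (ℕ; _≤_)
open import Data.Fin.Subset using (Subset; _∈_; ⁅_⁆; _∪_; ⊥)
open import Data.Fin.Subset.Properties using (x∈⁅x⁆; x∈⁅y⁆⇒x≡y; x∈p∪q⁺; x∈p∪q⁻; ∉⊥)
open import Data.List using (List; []; _∷_)
open import Data.List.Relation.Unary.All as All using (All; []; _∷_)
open import Data.List.Relation.Unary.Any using (Any; here; there)
open import Data.Product using (_,_; proj₁)
open import Data.Sum using (inj₁; inj₂)
open import Function.Bundles using (_⇔_; mk⇔)
open import Relation.Binary.PropositionalEquality using (refl)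
open import Relation.Nullary using (contradiction)

module _ {d k : ℕ} (H : Word d → Set) where

  vertexEq⇒𝒜 : ∀ {i' g' i g} → VertexEq k H (i' , g') (i , g) → 𝒜 k H (i' , g') g
  vertexEq⇒𝒜 (_ , sameClass) = refl , sameClass

  typesOf : List (Vertex d) → Subset (ℕ.suc d)
  typesOf []            = ⊥
  typesOf ((i , _) ∷ σ) = ⁅ i ⁆ ∪ typesOf σ

  type∈typesOf : ∀ {σ} → All (λ v → proj₁ v ∈ typesOf σ) σ
  type∈typesOf {[]}          = []
  type∈typesOf {(i , _) ∷ σ} =
    x∈p∪q⁺ (inj₁ (x∈⁅x⁆ i)) ∷ All.map (λ i∈σ → x∈p∪q⁺ (inj₂ i∈σ)) type∈typesOf

  ∈typesOf⇒vertexEq : ∀ {σ g} → All (λ v → 𝒜 k H v g) σ →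
                      ∀ i → i ∈ typesOf σ → Any (λ v → VertexEq k H v (i , g)) σ
  ∈typesOf⇒vertexEq {[]}          []       i i∈σ = contradiction i∈σ ∉⊥
  ∈typesOf⇒vertexEq {(j , _) ∷ σ} (a ∷ as) i i∈σ with x∈p∪q⁻ ⁅ j ⁆ (typesOf σ) i∈σ
  ... | inj₂ i∈τ = there (∈typesOf⇒vertexEq as i i∈τ)
  ... | inj₁ i∈j with x∈⁅y⁆⇒x≡y j i∈j
  ...   | refl = here a

  cell𝔛⇒cell𝒩 : ∀ σ → IsCell𝔛 k H σ → IsCell𝒩 k H σ
  cell𝔛⇒cell𝒩 σ (_ , g , sameClasses , _) =
    g , All.map (λ (_ , _ , e) → vertexEq⇒𝒜 e) sameClasses

  cell𝒩⇒cell𝔛 : ∀ σ → IsCell𝒩 k H σ → IsCell𝔛 k H σ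
  cell𝒩⇒cell𝔛 σ (g , common) =
    typesOf σ , g ,
    All.zipWith (λ (i∈σ , a) → _ , i∈σ , a) (type∈typesOf , common) ,
    ∈typesOf⇒vertexEq common

theorem9p1 : (d k : ℕ) → 1 ≤ d → 1 ≤ k → (H : Word d → Set) → IsSubgroup d k H →
    (σ : List (Vertex d)) → IsCell𝔛 k H σ ⇔ IsCell𝒩 k H σ
theorem9p1 d k _ _ H _ σ = mk⇔ (cell𝔛⇒cell𝒩 H σ) (cell𝒩⇒cell𝔛 H σ)
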